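{- Let $Z\in\Omega(\mathbf{d})$, let $p\in\{0,1,2\}$, $q\in\{0,1,2,3\}$ and $L\in C(p,q)$, and let $a_1,b_1$ be distinct vertices with $L(a_1,b_1)\neq 0$. (i) The number of ordered pairs of vertices $(a_2,b_2)$ with $L(a_2,b_2)=1$, $L(a_2,b_1)=0$ and $a_1,b_1,a_2,b_2$ all distinct is at least \[ M-4p+2q-\Big(d_{\max}\big(d_{\max}-\zeta_{b_1}+2\eta_{b_1}+2\big)+\eta_{a_1}+\eta_{b_1}-2(\zeta_{a_1}+\zeta_{b_1})+\sum_{y\in\widehat N_L(b_1)}(\eta_y-2\zeta_y)\Big).\] (ii) Suppose further that $a_1,b_1,a_2,b_2$ are distinct vertices with $L(a_2,b_2)=1$, and set $\eta^*=\eta_{a_1}+\eta_{b_1}+\eta_{a_2}+\eta_{b_2}$, $\zeta^*=\zeta_{a_1}+\zeta_{b_1}+\zeta_{a_2}+\zeta_{b_2}$. The number of ordered pairs $(a_3,b_3)$ with $L(a_3,b_3)=1$, $L(a_1,b_3)=L(a_3,b_2)=0$ and $a_1,b_1,a_2,b_2,a_3,b_3$ all distinct is at least \[ M-4p+2q-\Big(d_{\max}\big(2d_{\max}-(\zeta_{a_1}+\zeta_{b_2})+2(\eta_{a_1}+\eta_{b_2})+4\big)+\eta^*-2\zeta^*+\sum_{x\in\widehat N_L(a_1)}(\eta_x-2\zeta_x)+\sum_{y\in\widehat N_L(b_2)}(\eta_y-2\zeta_y)\Big).\]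
   Context: $\mathbf{d}=(d_1,\ldots,d_n)$ is a graphical degree sequence, $M=\sum_j d_j$, $d_{\max}=\max_j d_j$, and $\Omega(\mathbf{d})$ is the set of simple graphs on $[n]$ with degree sequence $\mathbf{d}$, identified with their symmetric 0-1 adjacency matrices. An encoding is a symmetric $n\times n$ matrix $L$ with entries in $\{ -1,0,1,2\}$, zero diagonal, and $v$-th row sum $d_v$ for each $v$; it is viewed as an edge-labelled graph with an edge $\{v,w\}$ of label $L(v,w)$ whenever $L(v,w)\neq0$. Edges labelled $2$ are 2-defect edges, edges labelled $-1$ are $(-1)$-defect edges. $L$ is consistent with $Z$ if every entry of $L+Z$ is in $\{0,1,2\}$. $L$ is valid if it has at most four defect edges and the labelled graph formed by its defect edges is isomorphic (as a labelled graph) to a subgraph of one of the following five labelled graphs, where "?" means the label may be $-1$ or $2$ (all named vertices distinct): (1) $c u$ labelled 2, $cv$ and $cw$ labelled $-1$, and a further edge $xy$ labelled ?; (2) $cu$ labelled 2, $cv,cw$ labelled $-1$, $wx$ labelled ?; (3) $cu,cv$ labelled $-1$, $cw$ labelled 2, $wx$ labelled ?; (4) $cu$ labelled 2, $cv,cw$ labelled $-1$, $uw$ labelled ?; (5) $cu$ labelled $-1$, $cv$ labelled 2, $cw$ labelled $-1$, $uw$ labelled ?. A valid $L$ is good if for all distinct $x,y,z$: if $L(x,y)=2$ then $d_x,d_y\ge2$; if $L(x,y)=L(y,z)=2$ then $d_y\ge4$; if $L(x,y)=2$ and $L(y,z)=-1$ then $d_y\ge3$. $C(p,q)$ is the set of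 good encodings consistent with $Z$ with exactly $p$ 2-defect edges and exactly $q$ $(-1)$-defect edges. For a vertex $v$: $N_L(v)=\{w\neq v: L(v,w)=1\}$, $\widehat N_L(v)=\{w\neq v:L(v,w)\neq0\}$, $\zeta_v$ is the number of 2-defect edges at $v$ and $\eta_v$ the number of $(-1)$-defect edges at $v$. -}

module Defs where

open import Data.Nat as ℕ using (ℕ; _⊔_)
open import Data.Integer as ℤ using (ℤ; +_; -[1+_])
open import Data.Fin as Fin using (Fin)
open import Data.List using (List; []; _∷_; filter; length; map; foldr; allFin; cartesianProduct)
open import Data.List.Relation.Unary.Any using (Any)
open import Data.Product using (_×_; _,_; ∃)
open import Data.Sum using (_⊎_)
open import Relation.Binary.PropositionalEquality using (_≡_; _≢_)
open import Relation.Nullary using (¬_)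
open import Relation.Nullary.Decidable using (¬?; _×-dec_)

sumℕ : List ℕ → ℕ
sumℕ = foldr ℕ._+_ 0

sumℤ : List ℤ → ℤ
sumℤ = foldr ℤ._+_ (+ 0)

allPairs : (n : ℕ) → List (Fin n × Fin n)
allPairs n = cartesianProduct (allFin n) (allFin n)

M : {n : ℕ} → (Fin n → ℕ) → ℕ
M {n} d = sumℕ (map d (allFin n))

dmax : {n : ℕ} → (Fin n → ℕ) → ℕ
dmax {n} d = foldr _⊔_ 0 (map d (allFin n))

-- Ω(d): simple graphs on [n] with degree sequence d,
-- as symmetric 0-1 adjacency matrices with zero diagonal.

InΩ : {n : ℕ} → (Fin n → ℕ) → (Fin n → Fin n → ℕ) → Set
InΩ {n} d Z =
  (∀ v w → Z v w ≡ Z w v) ×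
  (∀ v w → Z v w ≡ 0 ⊎ Z v w ≡ 1) ×
  (∀ v → Z v v ≡ 0) ×
  (∀ v → sumℕ (map (Z v) (allFin n)) ≡ d v)

-1ℤ : ℤ
-1ℤ = -[1+ 0 ]

IsEncoding : {n : ℕ} → (Fin n → ℕ) → (Fin n → Fin n → ℤ) → Set
IsEncoding {n} d L =
  (∀ v w → L v w ≡ L w v) ×
  (∀ v w → L v w ≡ -1ℤ ⊎ L v w ≡ + 0 ⊎ L v w ≡ + 1 ⊎ L v w ≡ + 2) ×
  (∀ v → L v v ≡ + 0) ×
  (∀ v → sumℤ (map (L v) (allFin n)) ≡ + d v)

Consistent : {n : ℕ} → (Fin n → Fin n → ℤ) → (Fin n → Fin n → ℕ) → Set
Consistent L Z = ∀ v w →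
  (L v w ℤ.+ + Z v w ≡ + 0) ⊎ (L v w ℤ.+ + Z v w ≡ + 1) ⊎ (L v w ℤ.+ + Z v w ≡ + 2)

IsDefect : ℤ → Set
IsDefect a = a ≡ + 2 ⊎ a ≡ -1ℤ

numEdgesLabelled : {n : ℕ} → (Fin n → Fin n → ℤ) → ℤ → ℕ
numEdgesLabelled {n} L a =
  length (filter (λ (vw : Fin n × Fin n) →
                   let (v , w) = vw in (v Fin.<? w) ×-dec (L v w ℤ.≟ a))
                 (allPairs n))

numDefectEdges : {n : ℕ} → (Fin n → Fin n → ℤ) → ℕ
numDefectEdges L = numEdgesLabelled L (+ 2) ℕ.+ numEdgesLabelled L -1ℤ

-- The five template labelled graphs.  Vertex names:
-- c = 0, u = 1, v = 2, w = 3, x = 4, y = 5 (all distinct); unused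
-- vertices of a template are isolated and irrelevant for subgraphs.

data TLabel : Set where
  two minus anyL : TLabel

Compat : ℤ → TLabel → Set
Compat a two   = a ≡ + 2
Compat a minus = a ≡ -1ℤ
Compat a anyL  = a ≡ + 2 ⊎ a ≡ -1ℤ

Template : Set
Template = List (Fin 6 × Fin 6 × TLabel)

tc tu tv tw tx ty : Fin 6
tc = Fin.zero
tu = Fin.suc Fin.zero
tv = Fin.suc (Fin.suc Fin.zero)
tw = Fin.suc (Fin.suc (Fin.suc Fin.zero))
tx = Fin.suc (Fin.suc (Fin.suc (Fin.suc Fin.zero)))
ty = Fin.suc (Fin.suc (Fin.suc (Fin.suc (Fin.suc Fin.zero))))

template1 : Template
template1 = (tc , tu , two) ∷ (tc , tv , minus) ∷ (tc , tw , minus) ∷ (tx , ty , anyL) ∷ []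
template2 : Template
template2 = (tc , tu , two) ∷ (tc , tv , minus) ∷ (tc , tw , minus) ∷ (tw , tx , anyL) ∷ []
template3 : Template
template3 = (tc , tu , minus) ∷ (tc , tv , minus) ∷ (tc , tw , two) ∷ (tw , tx , anyL) ∷ []
template4 : Template
template4 = (tc , tu , two) ∷ (tc , tv , minus) ∷ (tc , tw , minus) ∷ (tu , tw , anyL) ∷ []
template5 : Template
template5 = (tc , tu , minus) ∷ (tc , tv , two) ∷ (tc , tw , minus) ∷ (tu , tw , anyL) ∷ []

HasEdge : Template → Fin 6 → Fin 6 → ℤ → Set
HasEdge T i j a =
  Any (λ (e : Fin 6 × Fin 6 × TLabel) →
         let (k , l , t) = e in
         ((k ≡ i × l ≡ j) ⊎ (k ≡ j × l ≡ i)) × Compat a t) T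

InDefectGraph : {n : ℕ} → (Fin n → Fin n → ℤ) → Fin n → Set
InDefectGraph {n} L v = ∃ λ (w : Fin n) → IsDefect (L v w)

-- The labelled graph formed by the defect edges of L is isomorphic (as a
-- labelled graph) to a subgraph of T: there is a map φ, injective on the
-- vertices of the defect graph, sending every defect edge to an edge of T
-- with a matching label.
DefectGraphEmbedsIn : {n : ℕ} → (Fin n → Fin n → ℤ) → Template → Set
DefectGraphEmbedsIn {n} L T =
  ∃ λ (φ : Fin n → Fin 6) →
    (∀ v w → InDefectGraph L v → InDefectGraph L w → φ v ≡ φ w → v ≡ w) ×
    (∀ v w → IsDefect (L v w) → HasEdge T (φ v) (φ w) (L v w))

Valid : {n : ℕ} → (Fin n → Fin n → ℤ) → Set
Valid L =
  numDefectEdges L ℕ.≤ 4 ×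
  (DefectGraphEmbedsIn L template1 ⊎ DefectGraphEmbedsIn L template2 ⊎
   DefectGraphEmbedsIn L template3 ⊎ DefectGraphEmbedsIn L template4 ⊎
   DefectGraphEmbedsIn L template5)

Good : {n : ℕ} → (Fin n → ℕ) → (Fin n → Fin n → ℤ) → Set
Good {n} d L =
  Valid L ×
  (∀ x y → x ≢ y → L x y ≡ + 2 → 2 ℕ.≤ d x × 2 ℕ.≤ d y) ×
  (∀ x y z → x ≢ y → y ≢ z → x ≢ z →
     L x y ≡ + 2 → L y z ≡ + 2 → 4 ℕ.≤ d y) ×
  (∀ x y z → x ≢ y → y ≢ z → x ≢ z →
     L x y ≡ + 2 → L y z ≡ -1ℤ → 3 ℕ.≤ d y)

InC : {n : ℕ} → (Fin n → ℕ) → (Fin n → Fin n → ℕ) → ℕ → ℕ →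
      (Fin n → Fin n → ℤ) → Set
InC d Z p q L =
  IsEncoding d L × Good d L × Consistent L Z ×
  numEdgesLabelled L (+ 2) ≡ p × numEdgesLabelled L -1ℤ ≡ q

ζ : {n : ℕ} → (Fin n → Fin n → ℤ) → Fin n → ℕ
ζ {n} L v = length (filter (λ w → L v w ℤ.≟ + 2) (allFin n))

η : {n : ℕ} → (Fin n → Fin n → ℤ) → Fin n → ℕ
η {n} L v = length (filter (λ w → L v w ℤ.≟ -1ℤ) (allFin n))

Nhat : {n : ℕ} → (Fin n → Fin n → ℤ) → Fin n → List (Fin n)
Nhat {n} L v =
  filter (λ w → ¬? (w Fin.≟ v) ×-dec ¬? (L v w ℤ.≟ + 0)) (allFin n)

sumNhat : {n : ℕ} → (Fin n → Fin n → ℤ) → Fin n → ℤ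
sumNhat L v =
  sumℤ (map (λ y → + η L y ℤ.- + 2 ℤ.* + ζ L y) (Nhat L v))

count1 : {n : ℕ} → (Fin n → Fin n → ℤ) → Fin n → Fin n → ℕ
count1 {n} L a₁ b₁ =
  length (filter
    (λ (ab : Fin n × Fin n) → let (a₂ , b₂) = ab in
        (L a₂ b₂ ℤ.≟ + 1) ×-dec (L a₂ b₁ ℤ.≟ + 0) ×-dec
        ¬? (a₂ Fin.≟ a₁) ×-dec ¬? (a₂ Fin.≟ b₁) ×-dec
        ¬? (b₂ Fin.≟ a₁) ×-dec ¬? (b₂ Fin.≟ b₁) ×-dec ¬? (a₂ Fin.≟ b₂))
    (allPairs n))

count2 : {n : ℕ} → (Fin n → Fin n → ℤ) → Fin n → Fin n → Fin n → Fin n → ℕ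
count2 {n} L a₁ b₁ a₂ b₂ =
  length (filter
    (λ (ab : Fin n × Fin n) → let (a₃ , b₃) = ab in
        (L a₃ b₃ ℤ.≟ + 1) ×-dec (L a₁ b₃ ℤ.≟ + 0) ×-dec (L a₃ b₂ ℤ.≟ + 0) ×-dec
        ¬? (a₃ Fin.≟ a₁) ×-dec ¬? (a₃ Fin.≟ b₁) ×-dec
        ¬? (a₃ Fin.≟ a₂) ×-dec ¬? (a₃ Fin.≟ b₂) ×-dec
        ¬? (b₃ Fin.≟ a₁) ×-dec ¬? (b₃ Fin.≟ b₁) ×-dec
        ¬? (b₃ Fin.≟ a₂) ×-dec ¬? (b₃ Fin.≟ b₂) ×-dec ¬? (a₃ Fin.≟ b₃))
    (allPairs n))

Distinct4 : {n : ℕ} → Fin n → Fin n → Fin n → Fin n → Set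
Distinct4 a b c e =
  a ≢ b × a ≢ c × a ≢ e × b ≢ c × b ≢ e × c ≢ e

-- The ordered pairs (a , b) with L(a,b) = 1 number Σ_v |N_L(v)| = M - 4p + 2q:
-- row v of L sums to d_v = |N_L(v)| + 2ζ_v - η_v, and summing ζ (resp. η) over all vertices
-- counts every 2-defect (resp. (-1)-defect) edge twice.  Such a pair is missed by the count
-- only through a few failure events, each of which is counted separately: in (i) L(b₁,a) ≠ 0,
-- a = b₁ or b = a₁ (the remaining conditions, e.g. a ≠ a₁ and b ≠ b₁, then follow from
-- L(a₁,b₁) ≠ 0).  Pairs with a fixed endpoint v number |N_L(v)| ≤ d_max - 2ζ_v + η_v, and pairs
-- with a ∈ N̂_L(v) number Σ_{a ∈ N̂_L(v)} |N_L(a)| ≤ d_max |N̂_L(v)| + Σ_{a ∈ N̂_L(v)} (η_a - 2ζ_a).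

module Submission where

open import Defs
open import Data.Nat as ℕ using (ℕ)
open import Data.Integer as ℤ using (ℤ; +_)
open import Data.Fin using (Fin)
open import Data.Product using (_×_)
open import Relation.Binary.PropositionalEquality using (_≡_; _≢_)

open import Data.Bool using (true; false; if_then_else_)
open import Data.Fin as Fin using (_≟_; _<?_)
import Data.Fin.Properties as FinP
open import Data.Integer using (_+_; _*_; _-_; _≤_; +≤+)
import Data.Integer.Properties as ℤP
open import Algebra.Properties.Semiring.Sum ℤP.+-*-semiring
  using (sum; sum-syntax; sum-cong-≗; sum-replicate-zero; ∑-distrib-+; ∑-comm; *-distribˡ-sum; *-distribʳ-sum)
open import Data.Integer.Tactic.RingSolver using (solve-∀)
open import Data.List using (List; []; _∷_; _++_; map; filter; length; tabulate; allFin; cartesianProduct)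
open import Data.List.Membership.Propositional.Properties using (∈-map⁺; ∈-allFin)
open import Data.List.Properties using (foldr-preservesᵒ)
import Data.List.Relation.Unary.Any as Any
open import Data.Nat using (zero; suc; z≤n; s≤s; _⊔_)
import Data.Nat.Properties as ℕP
open import Data.Product using (_,_; proj₁; proj₂)
open import Data.Sum using (_⊎_; inj₁; inj₂; [_,_])
open import Function using (_∘_; id)
open import Relation.Binary using (tri<; tri≈; tri>)
open import Relation.Binary.PropositionalEquality
  using (refl; sym; trans; cong; cong₂; subst; subst₂; module ≡-Reasoning)
open import Relation.Nullary using (Dec; yes; no; does; ¬_; ¬?; _×-dec_; _⊎-dec_; contradiction)
open import Relation.Unary using (Pred; Decidable)

variable
  A B : Set
  n : ℕ

𝟙 : {P : Set} → Dec P → ℤ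
𝟙 P? = if does P? then + 1 else + 0

𝟙-no : {P : Set} → ¬ P → (P? : Dec P) → 𝟙 P? ≡ + 0
𝟙-no ¬p (yes p) = contradiction p ¬p
𝟙-no _  (no _)  = refl

𝟙-*-mono-≤ : {P : Set} (P? : Dec P) {x y : ℤ} → x ≤ y → 𝟙 P? * x ≤ 𝟙 P? * y
𝟙-*-mono-≤ (yes _) {x} {y} x≤y = subst₂ _≤_ (sym (ℤP.*-identityˡ x)) (sym (ℤP.*-identityˡ y)) x≤y
𝟙-*-mono-≤ (no _)  _           = ℤP.≤-refl

𝟙-cover : {P Q F : Set} (P? : Dec P) (Q? : Dec Q) (F? : Dec F) →
          (P → Q ⊎ F) → 𝟙 P? ≤ 𝟙 Q? + 𝟙 P? * 𝟙 F?
𝟙-cover (yes p) (no ¬q) (no ¬f) P⇒Q⊎F = contradiction (P⇒Q⊎F p) [ ¬q , ¬f ]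
𝟙-cover (yes _) (yes _) (yes _) _     = +≤+ (s≤s z≤n)
𝟙-cover (yes _) (yes _) (no _)  _     = +≤+ (s≤s z≤n)
𝟙-cover (yes _) (no _)  (yes _) _     = +≤+ (s≤s z≤n)
𝟙-cover (no _)  (yes _) _       _     = +≤+ z≤n
𝟙-cover (no _)  (no _)  _       _     = +≤+ z≤n

𝟙-*-⊎-≤ : {Q F G : Set} (Q? : Dec Q) (F? : Dec F) (G? : Dec G) →
          𝟙 Q? * 𝟙 (F? ⊎-dec G?) ≤ 𝟙 Q? * 𝟙 F? + 𝟙 Q? * 𝟙 G?
𝟙-*-⊎-≤ (yes _) (yes _) (yes _) = +≤+ (s≤s z≤n)
𝟙-*-⊎-≤ (yes _) (yes _) (no _)  = +≤+ (s≤s z≤n)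
𝟙-*-⊎-≤ (yes _) (no _)  (yes _) = +≤+ (s≤s z≤n)
𝟙-*-⊎-≤ (yes _) (no _)  (no _)  = +≤+ z≤n
𝟙-*-⊎-≤ (no _)  _       _       = +≤+ z≤n

IsLabel : ℤ → Set
IsLabel x = x ≡ -1ℤ ⊎ x ≡ + 0 ⊎ x ≡ + 1 ⊎ x ≡ + 2

label-decomposition : (x : ℤ) → IsLabel x →
  x + 𝟙 (x ℤ.≟ -1ℤ) ≡ 𝟙 (x ℤ.≟ + 1) + + 2 * 𝟙 (x ℤ.≟ + 2)
label-decomposition _ (inj₁ refl)               = refl
label-decomposition _ (inj₂ (inj₁ refl))        = refl
label-decomposition _ (inj₂ (inj₂ (inj₁ refl))) = refl
label-decomposition _ (inj₂ (inj₂ (inj₂ refl))) = refl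

𝟙-nonzero-label : (x : ℤ) → IsLabel x →
  𝟙 (¬? (x ℤ.≟ + 0)) ≡ 𝟙 (x ℤ.≟ + 1) + 𝟙 (x ℤ.≟ + 2) + 𝟙 (x ℤ.≟ -1ℤ)
𝟙-nonzero-label _ (inj₁ refl)               = refl
𝟙-nonzero-label _ (inj₂ (inj₁ refl))        = refl
𝟙-nonzero-label _ (inj₂ (inj₂ (inj₁ refl))) = refl
𝟙-nonzero-label _ (inj₂ (inj₂ (inj₂ refl))) = refl

length-filter-𝟙 : {P : Pred A _} (P? : Decidable P) (xs : List A) →
                  + length (filter P? xs) ≡ sumℤ (map (𝟙 ∘ P?) xs)
length-filter-𝟙 P? []       = refl
length-filter-𝟙 P? (x ∷ xs) with does (P? x)
... | true  = cong (_+_ (+ 1)) (length-filter-𝟙 P? xs)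
... | false = trans (length-filter-𝟙 P? xs) (sym (ℤP.+-identityˡ _))

sumℤ-map-filter : {P : Pred A _} (P? : Decidable P) (h : A → ℤ) (xs : List A) →
                  sumℤ (map h (filter P? xs)) ≡ sumℤ (map (λ x → 𝟙 (P? x) * h x) xs)
sumℤ-map-filter P? h []       = refl
sumℤ-map-filter P? h (x ∷ xs) with does (P? x)
... | true  = cong₂ _+_ (sym (ℤP.*-identityˡ (h x))) (sumℤ-map-filter P? h xs)
... | false = trans (sumℤ-map-filter P? h xs) (sym (ℤP.+-identityˡ _))

sumℤ-map-++ : (h : A → ℤ) (xs ys : List A) →
              sumℤ (map h (xs ++ ys)) ≡ sumℤ (map h xs) + sumℤ (map h ys)
sumℤ-map-++ h []       ys = sym (ℤP.+-identityˡ _)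
sumℤ-map-++ h (x ∷ xs) ys =
  trans (cong (_+_ (h x)) (sumℤ-map-++ h xs ys)) (sym (ℤP.+-assoc (h x) _ _))

sumℤ-map-map : (h : B → ℤ) (g : A → B) (xs : List A) →
               sumℤ (map h (map g xs)) ≡ sumℤ (map (h ∘ g) xs)
sumℤ-map-map h g []       = refl
sumℤ-map-map h g (x ∷ xs) = cong (_+_ (h (g x))) (sumℤ-map-map h g xs)

sumℤ-map-cartesianProduct : (h : A × B → ℤ) (xs : List A) (ys : List B) →
  sumℤ (map h (cartesianProduct xs ys)) ≡ sumℤ (map (λ x → sumℤ (map (λ y → h (x , y)) ys)) xs)
sumℤ-map-cartesianProduct h []       ys = refl
sumℤ-map-cartesianProduct h (x ∷ xs) ys = trans
  (sumℤ-map-++ h (map (x ,_) ys) (cartesianProduct xs ys))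
  (cong₂ _+_ (sumℤ-map-map h (x ,_) ys) (sumℤ-map-cartesianProduct h xs ys))

sumℤ-map-tabulate : (h : A → ℤ) (g : Fin n → A) → sumℤ (map h (tabulate g)) ≡ sum (h ∘ g)
sumℤ-map-tabulate {n = zero}  h g = refl
sumℤ-map-tabulate {n = suc n} h g =
  cong (_+_ (h (g Fin.zero))) (sumℤ-map-tabulate h (g ∘ Fin.suc))

sumℤ-map-allFin : (h : Fin n → ℤ) → sumℤ (map h (allFin n)) ≡ sum h
sumℤ-map-allFin h = sumℤ-map-tabulate h id

pos-sumℕ : (xs : List ℕ) → + sumℕ xs ≡ sumℤ (map +_ xs)
pos-sumℕ []       = refl
pos-sumℕ (x ∷ xs) = trans (ℤP.pos-+ x (sumℕ xs)) (cong (_+_ (+ x)) (pos-sumℕ xs))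

pos-M : (d : Fin n → ℕ) → + M d ≡ ∑[ v < n ] (+ d v)
pos-M {n} d = trans (pos-sumℕ (map d (allFin n)))
  (trans (sumℤ-map-map +_ d (allFin n)) (sumℤ-map-allFin (+_ ∘ d)))

≤-dmax : (d : Fin n → ℕ) (v : Fin n) → d v ℕ.≤ dmax d
≤-dmax {n} d v = foldr-preservesᵒ ≤-⊔ 0 (map d (allFin n))
  (inj₂ (Any.map ℕP.≤-reflexive (∈-map⁺ d (∈-allFin v))))
  where
  ≤-⊔ : ∀ x y → d v ℕ.≤ x ⊎ d v ℕ.≤ y → d v ℕ.≤ x ⊔ y
  ≤-⊔ x y = [ (λ h → ℕP.≤-trans h (ℕP.m≤m⊔n x y)) , (λ h → ℕP.≤-trans h (ℕP.m≤n⊔m x y)) ]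

∑-mono-≤ : {f g : Fin n → ℤ} → (∀ i → f i ≤ g i) → sum f ≤ sum g
∑-mono-≤ {zero}  _   = ℤP.≤-refl
∑-mono-≤ {suc n} f≤g = ℤP.+-mono-≤ (f≤g Fin.zero) (∑-mono-≤ (f≤g ∘ Fin.suc))

∑-δ : (v : Fin n) (f : Fin n → ℤ) → ∑[ i < n ] (𝟙 (i ≟ v) * f i) ≡ f v
∑-δ {suc n} Fin.zero f = trans
  (cong₂ _+_ (ℤP.*-identityˡ (f Fin.zero))
             (trans (sum-cong-≗ (ℤP.*-zeroˡ ∘ f ∘ Fin.suc)) (sum-replicate-zero n)))
  (ℤP.+-identityʳ (f Fin.zero))
∑-δ {suc n} (Fin.suc v) f =
  trans (cong₂ _+_ (ℤP.*-zeroˡ (f Fin.zero)) (∑-δ v (f ∘ Fin.suc))) (ℤP.+-identityˡ (f (Fin.suc v)))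

∑₂-distrib-+ : (f g : Fin n → Fin n → ℤ) →
  ∑[ a < n ] ∑[ b < n ] (f a b + g a b) ≡ ∑[ a < n ] ∑[ b < n ] f a b + ∑[ a < n ] ∑[ b < n ] g a b
∑₂-distrib-+ f g = trans (sum-cong-≗ (λ a → ∑-distrib-+ (f a) (g a)))
                         (∑-distrib-+ (λ a → sum (f a)) (λ a → sum (g a)))

∑₂-mono-≤ : {f g : Fin n → Fin n → ℤ} → (∀ a b → f a b ≤ g a b) →
  ∑[ a < n ] ∑[ b < n ] f a b ≤ ∑[ a < n ] ∑[ b < n ] g a b
∑₂-mono-≤ f≤g = ∑-mono-≤ (λ a → ∑-mono-≤ (f≤g a))

count-allFin : {P : Pred (Fin n) _} (P? : Decidable P) →
               + length (filter P? (allFin n)) ≡ ∑[ i < n ] 𝟙 (P? i)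
count-allFin {n} P? = trans (length-filter-𝟙 P? (allFin n)) (sumℤ-map-allFin (𝟙 ∘ P?))

count-allPairs : {P : Pred (Fin n × Fin n) _} (P? : Decidable P) →
                 + length (filter P? (allPairs n)) ≡ ∑[ a < n ] ∑[ b < n ] 𝟙 (P? (a , b))
count-allPairs {n} P? = begin
  + length (filter P? (allPairs n))
    ≡⟨ length-filter-𝟙 P? (allPairs n) ⟩
  sumℤ (map (𝟙 ∘ P?) (allPairs n))
    ≡⟨ sumℤ-map-cartesianProduct (𝟙 ∘ P?) (allFin n) (allFin n) ⟩
  sumℤ (map (λ a → sumℤ (map (λ b → 𝟙 (P? (a , b))) (allFin n))) (allFin n))
    ≡⟨ sumℤ-map-allFin (λ a → sumℤ (map (λ b → 𝟙 (P? (a , b))) (allFin n))) ⟩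
  ∑[ a < n ] sumℤ (map (λ b → 𝟙 (P? (a , b))) (allFin n))
    ≡⟨ sum-cong-≗ (λ a → sumℤ-map-allFin (λ b → 𝟙 (P? (a , b)))) ⟩
  ∑[ a < n ] ∑[ b < n ] 𝟙 (P? (a , b)) ∎
  where open ≡-Reasoning

count-cover : {P : Pred (Fin n × Fin n) _} {Q F : Fin n → Fin n → Set}
  (P? : Decidable P) (Q? : ∀ a b → Dec (Q a b)) (F? : ∀ a b → Dec (F a b)) →
  (∀ a b → Q a b → P (a , b) ⊎ F a b) →
  ∑[ a < n ] ∑[ b < n ] 𝟙 (Q? a b) ≤
    + length (filter P? (allPairs n)) + ∑[ a < n ] ∑[ b < n ] (𝟙 (Q? a b) * 𝟙 (F? a b))
count-cover P? Q? F? Q⇒P⊎F = ℤP.≤-trans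
  (∑₂-mono-≤ (λ a b → 𝟙-cover (Q? a b) (P? (a , b)) (F? a b) (Q⇒P⊎F a b)))
  (ℤP.≤-reflexive (trans (∑₂-distrib-+ (λ a b → 𝟙 (P? (a , b))) (λ a b → 𝟙 (Q? a b) * 𝟙 (F? a b)))
                         (cong (λ c → c + _) (sym (count-allPairs P?)))))

∑₂-𝟙-⊎-≤ : {Q F G : Fin n → Fin n → Set} {u v : ℤ}
  (Q? : ∀ a b → Dec (Q a b)) (F? : ∀ a b → Dec (F a b)) (G? : ∀ a b → Dec (G a b)) →
  ∑[ a < n ] ∑[ b < n ] (𝟙 (Q? a b) * 𝟙 (F? a b)) ≤ u →
  ∑[ a < n ] ∑[ b < n ] (𝟙 (Q? a b) * 𝟙 (G? a b)) ≤ v →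
  ∑[ a < n ] ∑[ b < n ] (𝟙 (Q? a b) * 𝟙 (F? a b ⊎-dec G? a b)) ≤ u + v
∑₂-𝟙-⊎-≤ Q? F? G? ≤u ≤v = ℤP.≤-trans
  (∑₂-mono-≤ (λ a b → 𝟙-*-⊎-≤ (Q? a b) (F? a b) (G? a b)))
  (ℤP.≤-trans (ℤP.≤-reflexive (∑₂-distrib-+ (λ a b → 𝟙 (Q? a b) * 𝟙 (F? a b))
                                           (λ a b → 𝟙 (Q? a b) * 𝟙 (G? a b))))
              (ℤP.+-mono-≤ ≤u ≤v))

m≤n+o⇒m-o≤n : {m n o : ℤ} → m ≤ n + o → m - o ≤ n
m≤n+o⇒m-o≤n {n = n} {o} m≤n+o =
  ℤP.≤-trans (ℤP.+-monoˡ-≤ (ℤ.- o) m≤n+o) (ℤP.≤-reflexive (add-sub n o))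
  where
  add-sub : ∀ x y → x + y - y ≡ x
  add-sub = solve-∀

x+y≡z+w⇒z≡x-w+y : {x y z w : ℤ} → x + y ≡ z + w → z ≡ x - w + y
x+y≡z+w⇒z≡x-w+y {x} {y} {z} {w} eq =
  trans (sub-add z w) (trans (cong (_- w) (sym eq)) (sub-comm x y w))
  where
  sub-add : ∀ z w → z ≡ z + w - w
  sub-add = solve-∀
  sub-comm : ∀ x y w → x + y - w ≡ x - w + y
  sub-comm = solve-∀

1≢0 : + 1 ≢ + 0
1≢0 ()

module Encoding {n : ℕ} {d : Fin n → ℕ} {L : Fin n → Fin n → ℤ} (enc : IsEncoding d L) where

  L-sym : ∀ v w → L v w ≡ L w v
  L-sym = proj₁ enc

  L-label : ∀ v w → IsLabel (L v w)
  L-label = proj₁ (proj₂ enc)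

  L-diag : ∀ v → L v v ≡ + 0
  L-diag = proj₁ (proj₂ (proj₂ enc))

  L-row : ∀ v → ∑[ w < n ] L v w ≡ + d v
  L-row v = trans (sym (sumℤ-map-allFin (L v))) (proj₂ (proj₂ (proj₂ enc)) v)

  one? : ∀ v w → Dec (L v w ≡ + 1)
  one? v w = L v w ℤ.≟ + 1

  inN̂? : ∀ v w → Dec (L v w ≢ + 0)
  inN̂? v w = ¬? (L v w ℤ.≟ + 0)

  deg : ℤ → Fin n → ℤ
  deg c v = ∑[ w < n ] 𝟙 (L v w ℤ.≟ c)

  ∣N∣ : Fin n → ℤ
  ∣N∣ = deg (+ 1)

  ∣N̂∣ : Fin n → ℤ
  ∣N̂∣ v = ∑[ w < n ] 𝟙 (inN̂? v w)

  +ζ≡deg : ∀ v → + ζ L v ≡ deg (+ 2) v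
  +ζ≡deg v = count-allFin (λ w → L v w ℤ.≟ + 2)

  +η≡deg : ∀ v → + η L v ≡ deg -1ℤ v
  +η≡deg v = count-allFin (λ w → L v w ℤ.≟ -1ℤ)

  d+η≡∣N∣+2ζ : ∀ v → + d v + + η L v ≡ ∣N∣ v + + 2 * + ζ L v
  d+η≡∣N∣+2ζ v = begin
    + d v + + η L v
      ≡⟨ cong₂ _+_ (sym (L-row v)) (+η≡deg v) ⟩
    ∑[ w < n ] L v w + deg -1ℤ v
      ≡⟨ sym (∑-distrib-+ (L v) (λ w → 𝟙 (L v w ℤ.≟ -1ℤ))) ⟩
    ∑[ w < n ] (L v w + 𝟙 (L v w ℤ.≟ -1ℤ))
      ≡⟨ sum-cong-≗ (λ w → label-decomposition (L v w) (L-label v w)) ⟩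
    ∑[ w < n ] (𝟙 (L v w ℤ.≟ + 1) + + 2 * 𝟙 (L v w ℤ.≟ + 2))
      ≡⟨ ∑-distrib-+ (λ w → 𝟙 (L v w ℤ.≟ + 1)) (λ w → + 2 * 𝟙 (L v w ℤ.≟ + 2)) ⟩
    ∣N∣ v + ∑[ w < n ] (+ 2 * 𝟙 (L v w ℤ.≟ + 2))
      ≡⟨ cong (_+_ (∣N∣ v)) (sym (trans (cong (_*_ (+ 2)) (+ζ≡deg v)) (*-distribˡ-sum (+ 2) (λ w → 𝟙 (L v w ℤ.≟ + 2))))) ⟩
    ∣N∣ v + + 2 * + ζ L v ∎
    where open ≡-Reasoning

  ∣N̂∣≡ : ∀ v → ∣N̂∣ v ≡ ∣N∣ v + + ζ L v + + η L v
  ∣N̂∣≡ v = begin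
    ∣N̂∣ v
      ≡⟨ sum-cong-≗ (λ w → 𝟙-nonzero-label (L v w) (L-label v w)) ⟩
    ∑[ w < n ] (𝟙 (L v w ℤ.≟ + 1) + 𝟙 (L v w ℤ.≟ + 2) + 𝟙 (L v w ℤ.≟ -1ℤ))
      ≡⟨ ∑-distrib-+ (λ w → 𝟙 (L v w ℤ.≟ + 1) + 𝟙 (L v w ℤ.≟ + 2)) (λ w → 𝟙 (L v w ℤ.≟ -1ℤ)) ⟩
    ∑[ w < n ] (𝟙 (L v w ℤ.≟ + 1) + 𝟙 (L v w ℤ.≟ + 2)) + deg -1ℤ v
      ≡⟨ cong (_+ deg -1ℤ v) (∑-distrib-+ (λ w → 𝟙 (L v w ℤ.≟ + 1)) (λ w → 𝟙 (L v w ℤ.≟ + 2))) ⟩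
    ∣N∣ v + deg (+ 2) v + deg -1ℤ v
      ≡⟨ sym (cong₂ (λ z e → ∣N∣ v + z + e) (+ζ≡deg v) (+η≡deg v)) ⟩
    ∣N∣ v + + ζ L v + + η L v ∎
    where open ≡-Reasoning

  ∣N∣≡ : ∀ v → ∣N∣ v ≡ + d v - + 2 * + ζ L v + + η L v
  ∣N∣≡ v = x+y≡z+w⇒z≡x-w+y {+ d v} {+ η L v} {∣N∣ v} {+ 2 * + ζ L v} (d+η≡∣N∣+2ζ v)

  D : ℤ
  D = + dmax d

  boundN : Fin n → ℤ
  boundN v = D - + 2 * + ζ L v + + η L v

  boundN̂ : Fin n → ℤ
  boundN̂ v = D * (D - + ζ L v + + 2 * + η L v) + sumNhat L v

  ∣N∣≤ : ∀ v → ∣N∣ v ≤ boundN v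
  ∣N∣≤ v = subst (_≤ boundN v) (sym (∣N∣≡ v))
    (ℤP.+-monoˡ-≤ (+ η L v) (ℤP.+-monoˡ-≤ (ℤ.- (+ 2 * + ζ L v)) (+≤+ (≤-dmax d v))))

  ∣N̂∣≤ : ∀ v → ∣N̂∣ v ≤ D - + ζ L v + + 2 * + η L v
  ∣N̂∣≤ v = begin
    ∣N̂∣ v                             ≡⟨ ∣N̂∣≡ v ⟩
    ∣N∣ v + + ζ L v + + η L v         ≤⟨ ℤP.+-monoˡ-≤ (+ η L v) (ℤP.+-monoˡ-≤ (+ ζ L v) (∣N∣≤ v)) ⟩
    boundN v + + ζ L v + + η L v      ≡⟨ regroup D (+ ζ L v) (+ η L v) ⟩
    D - + ζ L v + + 2 * + η L v       ∎
    where
    open ℤP.≤-Reasoning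
    regroup : ∀ x z e → x - + 2 * z + e + z + e ≡ x - z + + 2 * e
    regroup = solve-∀

  sumNhat≡ : ∀ v → sumNhat L v ≡ ∑[ w < n ] (𝟙 (¬? (L v w ℤ.≟ + 0)) * (+ η L w - + 2 * + ζ L w))
  sumNhat≡ v = trans (sumℤ-map-filter _ h (allFin n))
    (trans (sumℤ-map-allFin (λ w → 𝟙 (¬? (w ≟ v) ×-dec ¬? (L v w ℤ.≟ + 0)) * h w)) (sum-cong-≗ drop-w≢v))
    where
    h : Fin n → ℤ
    h w = + η L w - + 2 * + ζ L w
    drop-w≢v : ∀ w → 𝟙 (¬? (w ≟ v) ×-dec ¬? (L v w ℤ.≟ + 0)) * h w ≡ 𝟙 (¬? (L v w ℤ.≟ + 0)) * h w
    drop-w≢v w with w ≟ v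
    ... | yes refl rewrite L-diag v = refl
    ... | no _     = refl

  ∑-N̂-∣N∣≤ : ∀ v → ∑[ a < n ] (𝟙 (¬? (L v a ℤ.≟ + 0)) * ∣N∣ a) ≤ boundN̂ v
  ∑-N̂-∣N∣≤ v = begin
    ∑[ a < n ] (χ a * ∣N∣ a)                          ≤⟨ ∑-mono-≤ (λ a → 𝟙-*-mono-≤ (inN̂? v a) (∣N∣≤ a)) ⟩
    ∑[ a < n ] (χ a * boundN a)                       ≡⟨ sum-cong-≗ (λ a → split (χ a) D (+ ζ L a) (+ η L a)) ⟩
    ∑[ a < n ] (D * χ a + χ a * h a)                  ≡⟨ ∑-distrib-+ (λ a → D * χ a) (λ a → χ a * h a) ⟩
    ∑[ a < n ] (D * χ a) + ∑[ a < n ] (χ a * h a)     ≡⟨ cong₂ _+_ (sym (*-distribˡ-sum D χ)) (sym (sumNhat≡ v)) ⟩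
    D * ∣N̂∣ v + sumNhat L v                           ≤⟨ ℤP.+-monoˡ-≤ (sumNhat L v) (ℤP.*-monoˡ-≤-nonNeg D (∣N̂∣≤ v)) ⟩
    boundN̂ v                                          ∎
    where
    open ℤP.≤-Reasoning
    χ h : Fin n → ℤ
    χ a = 𝟙 (inN̂? v a)
    h a = + η L a - + 2 * + ζ L a
    split : ∀ k x z e → k * (x - + 2 * z + e) ≡ x * k + k * (e - + 2 * z)
    split = solve-∀

  edge-split : ∀ {c} → c ≢ + 0 → ∀ v w →
    𝟙 (L v w ℤ.≟ c) ≡ 𝟙 ((v <? w) ×-dec (L v w ℤ.≟ c)) + 𝟙 ((w <? v) ×-dec (L w v ℤ.≟ c))
  edge-split {c} c≢0 v w = by-order (v <? w) (w <? v)
    where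
    by-order : (v<w? : Dec (v Fin.< w)) (w<v? : Dec (w Fin.< v)) →
      𝟙 (L v w ℤ.≟ c) ≡ 𝟙 (v<w? ×-dec (L v w ℤ.≟ c)) + 𝟙 (w<v? ×-dec (L w v ℤ.≟ c))
    by-order (yes v<w) (yes w<v) = contradiction w<v (FinP.<-asym v<w)
    by-order (yes _)   (no _)    = sym (ℤP.+-identityʳ _)
    by-order (no _)    (yes _)   rewrite L-sym v w = sym (ℤP.+-identityˡ _)
    by-order (no v≮w)  (no w≮v)  with FinP.<-cmp v w
    ... | tri< v<w _ _ = contradiction v<w v≮w
    ... | tri> _ _ w<v = contradiction w<v w≮v
    ... | tri≈ _ v≡w _ = 𝟙-no (λ Lvw≡c → c≢0 (trans (sym Lvw≡c) Lvw≡0)) (L v w ℤ.≟ c)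
      where
      Lvw≡0 : L v w ≡ + 0
      Lvw≡0 = trans (cong (L v) (sym v≡w)) (L-diag v)

  handshake : ∀ {c} → c ≢ + 0 → ∑[ v < n ] deg c v ≡ + 2 * + numEdgesLabelled L c
  handshake {c} c≢0 = begin
    ∑[ v < n ] deg c v
      ≡⟨ sum-cong-≗ (λ v → sum-cong-≗ (edge-split c≢0 v)) ⟩
    ∑[ v < n ] ∑[ w < n ] (E v w + E w v)
      ≡⟨ ∑₂-distrib-+ E (λ v w → E w v) ⟩
    ∑[ v < n ] ∑[ w < n ] E v w + ∑[ v < n ] ∑[ w < n ] E w v
      ≡⟨ cong (_+_ (∑[ v < n ] ∑[ w < n ] E v w)) (∑-comm (λ v w → E w v)) ⟩
    ∑[ v < n ] ∑[ w < n ] E v w + ∑[ v < n ] ∑[ w < n ] E v w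
      ≡⟨ cong (λ x → x + x) (sym (count-allPairs {n} _)) ⟩
    + numEdgesLabelled L c + + numEdgesLabelled L c
      ≡⟨ double (+ numEdgesLabelled L c) ⟩
    + 2 * + numEdgesLabelled L c ∎
    where
    open ≡-Reasoning
    E : Fin n → Fin n → ℤ
    E v w = 𝟙 ((v <? w) ×-dec (L v w ℤ.≟ c))
    double : ∀ x → x + x ≡ + 2 * x
    double = solve-∀

  ∑ζ≡ : ∑[ v < n ] (+ ζ L v) ≡ + 2 * + numEdgesLabelled L (+ 2)
  ∑ζ≡ = trans (sum-cong-≗ +ζ≡deg) (handshake λ ())

  ∑η≡ : ∑[ v < n ] (+ η L v) ≡ + 2 * + numEdgesLabelled L -1ℤ
  ∑η≡ = trans (sum-cong-≗ +η≡deg) (handshake λ ())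

  ∑∣N∣≡ : ∀ {p q} → numEdgesLabelled L (+ 2) ≡ p → numEdgesLabelled L -1ℤ ≡ q →
          ∑[ v < n ] ∣N∣ v ≡ + M d - + 4 * + p + + 2 * + q
  ∑∣N∣≡ {p} {q} refl refl =
    x+y≡z+w⇒z≡x-w+y {+ M d} {+ 2 * + q} {∑[ v < n ] ∣N∣ v} {+ 4 * + p} (begin
    + M d + + 2 * + q
      ≡⟨ cong₂ _+_ (pos-M d) (sym ∑η≡) ⟩
    ∑[ v < n ] (+ d v) + ∑[ v < n ] (+ η L v)
      ≡⟨ sym (∑-distrib-+ (λ v → + d v) (λ v → + η L v)) ⟩
    ∑[ v < n ] (+ d v + + η L v)
      ≡⟨ sum-cong-≗ d+η≡∣N∣+2ζ ⟩
    ∑[ v < n ] (∣N∣ v + + 2 * + ζ L v)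
      ≡⟨ ∑-distrib-+ ∣N∣ (λ v → + 2 * + ζ L v) ⟩
    ∑[ v < n ] ∣N∣ v + ∑[ v < n ] (+ 2 * + ζ L v)
      ≡⟨ cong (_+_ (∑[ v < n ] ∣N∣ v)) (sym (*-distribˡ-sum (+ 2) (λ v → + ζ L v))) ⟩
    ∑[ v < n ] ∣N∣ v + + 2 * ∑[ v < n ] (+ ζ L v)
      ≡⟨ cong (λ x → ∑[ v < n ] ∣N∣ v + + 2 * x) ∑ζ≡ ⟩
    ∑[ v < n ] ∣N∣ v + + 2 * (+ 2 * + p)
      ≡⟨ cong (_+_ (∑[ v < n ] ∣N∣ v)) (sym (ℤP.*-assoc (+ 2) (+ 2) (+ p))) ⟩
    ∑[ v < n ] ∣N∣ v + + 4 * + p ∎)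
    where open ≡-Reasoning

  ∑₂-row : (g : Fin n → ℤ) →
    ∑[ a < n ] ∑[ b < n ] (𝟙 (one? a b) * g a) ≡ ∑[ a < n ] (g a * ∣N∣ a)
  ∑₂-row g = sum-cong-≗ λ a →
    trans (sym (*-distribʳ-sum (g a) (𝟙 ∘ one? a))) (ℤP.*-comm (∣N∣ a) (g a))

  ∑₂-col : (h : Fin n → ℤ) →
    ∑[ a < n ] ∑[ b < n ] (𝟙 (one? a b) * h b) ≡ ∑[ b < n ] (h b * ∣N∣ b)
  ∑₂-col h = trans (∑-comm (λ a b → 𝟙 (one? a b) * h b)) (trans
    (sum-cong-≗ λ b → sum-cong-≗ λ a → cong (λ x → 𝟙 (x ℤ.≟ + 1) * h b) (L-sym a b))
    (∑₂-row h))

  row-≤ : {G : Fin n → Set} (G? : ∀ a → Dec (G a)) {u : ℤ} → ∑[ a < n ] (𝟙 (G? a) * ∣N∣ a) ≤ u →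
          ∑[ a < n ] ∑[ b < n ] (𝟙 (one? a b) * 𝟙 (G? a)) ≤ u
  row-≤ G? = ℤP.≤-trans (ℤP.≤-reflexive (∑₂-row (𝟙 ∘ G?)))

  col-≤ : {G : Fin n → Set} (G? : ∀ b → Dec (G b)) {u : ℤ} → ∑[ b < n ] (𝟙 (G? b) * ∣N∣ b) ≤ u →
          ∑[ a < n ] ∑[ b < n ] (𝟙 (one? a b) * 𝟙 (G? b)) ≤ u
  col-≤ G? = ℤP.≤-trans (ℤP.≤-reflexive (∑₂-col (𝟙 ∘ G?)))

  ∑-δ-∣N∣≤ : ∀ v → ∑[ a < n ] (𝟙 (a ≟ v) * ∣N∣ a) ≤ boundN v
  ∑-δ-∣N∣≤ v = ℤP.≤-trans (ℤP.≤-reflexive (∑-δ v ∣N∣)) (∣N∣≤ v)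

  counted₁-or-failure : ∀ {a₁ b₁} → L a₁ b₁ ≢ + 0 → ∀ a b → L a b ≡ + 1 →
    (L a b ≡ + 1 × L a b₁ ≡ + 0 × ¬ a ≡ a₁ × ¬ a ≡ b₁ × ¬ b ≡ a₁ × ¬ b ≡ b₁ × ¬ a ≡ b)
    ⊎ (L b₁ a ≢ + 0 ⊎ a ≡ b₁ ⊎ b ≡ a₁)
  counted₁-or-failure {a₁} {b₁} La₁b₁≢0 a b Lab≡1
    with L b₁ a ℤ.≟ + 0 | a ≟ b₁ | b ≟ a₁
  ... | no Lb₁a≢0 | _        | _        = inj₂ (inj₁ Lb₁a≢0)
  ... | yes _     | yes a≡b₁ | _        = inj₂ (inj₂ (inj₁ a≡b₁))
  ... | yes _     | no _     | yes b≡a₁ = inj₂ (inj₂ (inj₂ b≡a₁))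
  ... | yes Lb₁a≡0 | no a≢b₁ | no b≢a₁  =
    inj₁ (Lab≡1 , Lab₁≡0 , a≢a₁ , a≢b₁ , b≢a₁ , b≢b₁ , a≢b)
    where
    Lab₁≡0 : L a b₁ ≡ + 0
    Lab₁≡0 = trans (L-sym a b₁) Lb₁a≡0
    a≢a₁ : ¬ a ≡ a₁
    a≢a₁ a≡a₁ = La₁b₁≢0 (trans (cong (λ x → L x b₁) (sym a≡a₁)) Lab₁≡0)
    b≢b₁ : ¬ b ≡ b₁
    b≢b₁ b≡b₁ = 1≢0 (trans (sym Lab≡1) (trans (cong (L a) b≡b₁) Lab₁≡0))
    a≢b : ¬ a ≡ b
    a≢b a≡b = 1≢0 (trans (sym Lab≡1) (trans (cong (L a) (sym a≡b)) (L-diag a)))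

  count1-bound : ∀ {a₁ b₁} → L a₁ b₁ ≢ + 0 →
    ∑[ v < n ] ∣N∣ v ≤ + count1 L a₁ b₁ + (boundN̂ b₁ + (boundN b₁ + boundN a₁))
  count1-bound {a₁} {b₁} La₁b₁≢0 = ℤP.≤-trans
    (count-cover _ one? (λ a b → F₁ a b ⊎-dec F₂ a b ⊎-dec F₃ a b)
                 (counted₁-or-failure La₁b₁≢0))
    (ℤP.+-monoʳ-≤ (+ count1 L a₁ b₁)
      (∑₂-𝟙-⊎-≤ one? F₁ (λ a b → F₂ a b ⊎-dec F₃ a b) (row-≤ (inN̂? b₁) (∑-N̂-∣N∣≤ b₁))
      (∑₂-𝟙-⊎-≤ one? F₂ F₃ (row-≤ (_≟ b₁) (∑-δ-∣N∣≤ b₁)) (col-≤ (_≟ a₁) (∑-δ-∣N∣≤ a₁)))))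
    where
    F₁ : ∀ a b → Dec (L b₁ a ≢ + 0)
    F₁ a _ = inN̂? b₁ a
    F₂ : ∀ a b → Dec (a ≡ b₁)
    F₂ a _ = a ≟ b₁
    F₃ : ∀ a b → Dec (b ≡ a₁)
    F₃ _ b = b ≟ a₁

  counted₂-or-failure : ∀ {a₁ b₁ a₂ b₂} → L a₁ b₁ ≢ + 0 → L a₂ b₂ ≡ + 1 → ∀ a b → L a b ≡ + 1 →
    (L a b ≡ + 1 × L a₁ b ≡ + 0 × L a b₂ ≡ + 0 ×
     ¬ a ≡ a₁ × ¬ a ≡ b₁ × ¬ a ≡ a₂ × ¬ a ≡ b₂ ×
     ¬ b ≡ a₁ × ¬ b ≡ b₁ × ¬ b ≡ a₂ × ¬ b ≡ b₂ × ¬ a ≡ b)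
    ⊎ (L a₁ b ≢ + 0 ⊎ L b₂ a ≢ + 0 ⊎ a ≡ b₁ ⊎ a ≡ b₂ ⊎ b ≡ a₁ ⊎ b ≡ a₂)
  counted₂-or-failure {a₁} {b₁} {a₂} {b₂} La₁b₁≢0 La₂b₂≡1 a b Lab≡1
    with L a₁ b ℤ.≟ + 0 | L b₂ a ℤ.≟ + 0 | a ≟ b₁ | a ≟ b₂ | b ≟ a₁ | b ≟ a₂
  ... | no h  | _     | _     | _     | _     | _     = inj₂ (inj₁ h)
  ... | yes _ | no h  | _     | _     | _     | _     = inj₂ (inj₂ (inj₁ h))
  ... | yes _ | yes _ | yes h | _     | _     | _     = inj₂ (inj₂ (inj₂ (inj₁ h)))
  ... | yes _ | yes _ | no _  | yes h | _     | _     = inj₂ (inj₂ (inj₂ (inj₂ (inj₁ h))))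
  ... | yes _ | yes _ | no _  | no _  | yes h | _     = inj₂ (inj₂ (inj₂ (inj₂ (inj₂ (inj₁ h)))))
  ... | yes _ | yes _ | no _  | no _  | no _  | yes h = inj₂ (inj₂ (inj₂ (inj₂ (inj₂ (inj₂ h)))))
  ... | yes La₁b≡0 | yes Lb₂a≡0 | no a≢b₁ | no a≢b₂ | no b≢a₁ | no b≢a₂ =
    inj₁ (Lab≡1 , La₁b≡0 , Lab₂≡0 , a≢a₁ , a≢b₁ , a≢a₂ , a≢b₂ , b≢a₁ , b≢b₁ , b≢a₂ , b≢b₂ , a≢b)
    where
    Lab₂≡0 : L a b₂ ≡ + 0
    Lab₂≡0 = trans (L-sym a b₂) Lb₂a≡0
    a≢a₁ : ¬ a ≡ a₁
    a≢a₁ a≡a₁ = 1≢0 (trans (sym Lab≡1) (trans (cong (λ x → L x b) a≡a₁) La₁b≡0))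
    a≢a₂ : ¬ a ≡ a₂
    a≢a₂ a≡a₂ = 1≢0 (trans (sym La₂b₂≡1) (trans (cong (λ x → L x b₂) (sym a≡a₂)) Lab₂≡0))
    b≢b₁ : ¬ b ≡ b₁
    b≢b₁ b≡b₁ = La₁b₁≢0 (trans (cong (L a₁) (sym b≡b₁)) La₁b≡0)
    b≢b₂ : ¬ b ≡ b₂
    b≢b₂ b≡b₂ = 1≢0 (trans (sym Lab≡1) (trans (cong (L a) b≡b₂) Lab₂≡0))
    a≢b : ¬ a ≡ b
    a≢b a≡b = 1≢0 (trans (sym Lab≡1) (trans (cong (L a) (sym a≡b)) (L-diag a)))

  count2-bound : ∀ {a₁ b₁ a₂ b₂} → L a₁ b₁ ≢ + 0 → L a₂ b₂ ≡ + 1 →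
    ∑[ v < n ] ∣N∣ v ≤ + count2 L a₁ b₁ a₂ b₂ +
      (boundN̂ a₁ + (boundN̂ b₂ + (boundN b₁ + (boundN b₂ + (boundN a₁ + boundN a₂)))))
  count2-bound {a₁} {b₁} {a₂} {b₂} La₁b₁≢0 La₂b₂≡1 = ℤP.≤-trans
    (count-cover _ one? (λ a b → F₁ a b ⊎-dec F₂ a b ⊎-dec F₃ a b ⊎-dec F₄ a b ⊎-dec F₅ a b ⊎-dec F₆ a b)
                 (counted₂-or-failure La₁b₁≢0 La₂b₂≡1))
    (ℤP.+-monoʳ-≤ (+ count2 L a₁ b₁ a₂ b₂)
      (∑₂-𝟙-⊎-≤ one? F₁ (λ a b → F₂ a b ⊎-dec F₃ a b ⊎-dec F₄ a b ⊎-dec F₅ a b ⊎-dec F₆ a b)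
        (col-≤ (inN̂? a₁) (∑-N̂-∣N∣≤ a₁))
      (∑₂-𝟙-⊎-≤ one? F₂ (λ a b → F₃ a b ⊎-dec F₄ a b ⊎-dec F₅ a b ⊎-dec F₆ a b)
        (row-≤ (inN̂? b₂) (∑-N̂-∣N∣≤ b₂))
      (∑₂-𝟙-⊎-≤ one? F₃ (λ a b → F₄ a b ⊎-dec F₅ a b ⊎-dec F₆ a b) (row-≤ (_≟ b₁) (∑-δ-∣N∣≤ b₁))
      (∑₂-𝟙-⊎-≤ one? F₄ (λ a b → F₅ a b ⊎-dec F₆ a b) (row-≤ (_≟ b₂) (∑-δ-∣N∣≤ b₂))
      (∑₂-𝟙-⊎-≤ one? F₅ F₆ (col-≤ (_≟ a₁) (∑-δ-∣N∣≤ a₁)) (col-≤ (_≟ a₂) (∑-δ-∣N∣≤ a₂))))))))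
    where
    F₁ : ∀ a b → Dec (L a₁ b ≢ + 0)
    F₁ _ b = inN̂? a₁ b
    F₂ : ∀ a b → Dec (L b₂ a ≢ + 0)
    F₂ a _ = inN̂? b₂ a
    F₃ : ∀ a b → Dec (a ≡ b₁)
    F₃ a _ = a ≟ b₁
    F₄ : ∀ a b → Dec (a ≡ b₂)
    F₄ a _ = a ≟ b₂
    F₅ : ∀ a b → Dec (b ≡ a₁)
    F₅ _ b = b ≟ a₁
    F₆ : ∀ a b → Dec (b ≡ a₂)
    F₆ _ b = b ≟ a₂

bracket-i : ∀ (D ζa ζb ηa ηb s : ℤ) →
  (D * (D - ζb + + 2 * ηb) + s) + ((D - + 2 * ζb + ηb) + (D - + 2 * ζa + ηa))
  ≡ D * (D - ζb + + 2 * ηb + + 2) + ηa + ηb - + 2 * (ζa + ζb) + s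
bracket-i = solve-∀

bracket-ii : ∀ (D ζa ζb ζa' ζb' ηa ηb ηa' ηb' s s' : ℤ) →
  (D * (D - ζa + + 2 * ηa) + s) + ((D * (D - ζb' + + 2 * ηb') + s') +
    ((D - + 2 * ζb + ηb) + ((D - + 2 * ζb' + ηb') + ((D - + 2 * ζa + ηa) + (D - + 2 * ζa' + ηa')))))
  ≡ D * (+ 2 * D - (ζa + ζb') + + 2 * (ηa + ηb') + + 4) + (ηa + ηb + ηa' + ηb')
    - + 2 * (ζa + ζb + ζa' + ζb') + s + s'
bracket-ii = solve-∀

lemma2p4 : (n : ℕ) (d : Fin n → ℕ) (Z : Fin n → Fin n → ℕ) → InΩ d Z →
    (p q : ℕ) → p ℕ.≤ 2 → q ℕ.≤ 3 →
    (L : Fin n → Fin n → ℤ) → InC d Z p q L →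
    (a₁ b₁ : Fin n) → a₁ ≢ b₁ → L a₁ b₁ ≢ + 0 →
    (+ count1 L a₁ b₁ ℤ.≥
       + M d ℤ.- + 4 ℤ.* + p ℤ.+ + 2 ℤ.* + q
       ℤ.- (+ dmax d ℤ.* (+ dmax d ℤ.- + ζ L b₁ ℤ.+ + 2 ℤ.* + η L b₁ ℤ.+ + 2)
            ℤ.+ + η L a₁ ℤ.+ + η L b₁ ℤ.- + 2 ℤ.* (+ ζ L a₁ ℤ.+ + ζ L b₁)
            ℤ.+ sumNhat L b₁))
    ×
    ((a₂ b₂ : Fin n) → Distinct4 a₁ b₁ a₂ b₂ → L a₂ b₂ ≡ + 1 →
      + count2 L a₁ b₁ a₂ b₂ ℤ.≥
        + M d ℤ.- + 4 ℤ.* + p ℤ.+ + 2 ℤ.* + q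
        ℤ.- (+ dmax d ℤ.* (+ 2 ℤ.* + dmax d ℤ.- (+ ζ L a₁ ℤ.+ + ζ L b₂)
                            ℤ.+ + 2 ℤ.* (+ η L a₁ ℤ.+ + η L b₂) ℤ.+ + 4)
             ℤ.+ (+ η L a₁ ℤ.+ + η L b₁ ℤ.+ + η L a₂ ℤ.+ + η L b₂)
             ℤ.- + 2 ℤ.* (+ ζ L a₁ ℤ.+ + ζ L b₁ ℤ.+ + ζ L a₂ ℤ.+ + ζ L b₂)
             ℤ.+ sumNhat L a₁ ℤ.+ sumNhat L b₂))
lemma2p4 n d Z _ p q _ _ L (enc , _ , _ , #2-edges , #-1-edges) a₁ b₁ _ La₁b₁≢0 =
  m≤n+o⇒m-o≤n (subst₂ (λ x e → x ≤ + count1 L a₁ b₁ + e) (∑∣N∣≡ #2-edges #-1-edges)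
    (bracket-i D (+ ζ L a₁) (+ ζ L b₁) (+ η L a₁) (+ η L b₁) (sumNhat L b₁))
    (count1-bound La₁b₁≢0))
  , λ a₂ b₂ _ La₂b₂≡1 →
  m≤n+o⇒m-o≤n (subst₂ (λ x e → x ≤ + count2 L a₁ b₁ a₂ b₂ + e) (∑∣N∣≡ #2-edges #-1-edges)
    (bracket-ii D (+ ζ L a₁) (+ ζ L b₁) (+ ζ L a₂) (+ ζ L b₂)
                  (+ η L a₁) (+ η L b₁) (+ η L a₂) (+ η L b₂) (sumNhat L a₁) (sumNhat L b₂))
    (count2-bound La₁b₁≢0 La₂b₂≡1))
  where open Encoding enc
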